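{- Let $P$ be a finite poset with underlying set $V$ such that $\mathrm{inc}(P)$ is connected, and let $v\in V$. Then the map $t$ is a bijection from the set of circular acyclic orientations of $\mathrm{inc}(P)$ whose greatest sink is $v$ to the set of acyclic orientations of $\mathrm{inc}(P)$ having $v$ as their unique sink, with inverse $u$.
   Context: $\mathrm{inc}(P)$ is the graph on $V$ with an edge between $v,w$ iff they are incomparable in $P$. In an acyclic orientation of $\mathrm{inc}(P)$ the sinks are pairwise non-adjacent, hence pairwise comparable in $P$, so they form a chain; likewise the sources form a chain. "Greatest", "smallest", "second-largest" refer to the order of $P$. An acyclic orientation is circular if its smallest source is not less (in $P$) than its greatest sink. Flipping a sink (resp. source) $w$ means reversing every arrow incident to $w$. For a circular acyclic orientation $A$, $t(A)$ is obtained by repeatedly flipping the second-largest sink until an orientation with only one sink is reached. For an acyclic orientation $B$ with exactly one sink, $u(B)$ is obtained by repeatedly flipping the smallest source until a circular orientation is reached. -}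

module Defs where

open import Level using (0ℓ)
open import Data.Nat using (ℕ)
open import Data.Fin using (Fin)
open import Data.Fin.Properties using (_≟_)
open import Data.Bool using (Bool; true; false; T; if_then_else_; _∨_)
open import Data.Vec using (Vec; lookup; tabulate)
open import Data.Product using (Σ; _×_; _,_)
open import Data.Sum using (_⊎_)
open import Relation.Nullary using (¬_; Dec; does)
open import Relation.Binary.Core using (Rel)
open import Relation.Binary.Definitions using (Decidable)
open import Relation.Binary.Structures using (IsPartialOrder)
open import Relation.Binary.PropositionalEquality using (_≡_)
open import Relation.Binary.Construct.Closure.Transitive using (TransClosure)
open import Relation.Binary.Construct.Closure.ReflexiveTransitive using (Star)

record FinPoset (n : ℕ) : Set₁ where
  field
    _≼_            : Rel (Fin n) 0ℓ
    isPartialOrder : IsPartialOrder _≡_ _≼_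
    _≼?_           : Decidable _≼_

module _ {n : ℕ} (P : FinPoset n) where
  open FinPoset P

  _≺_ : Fin n → Fin n → Set
  x ≺ y = x ≼ y × ¬ (x ≡ y)

  -- edges of inc(P): incomparable pairs (automatically distinct)
  Incomparable : Fin n → Fin n → Set
  Incomparable x y = ¬ (x ≼ y) × ¬ (y ≼ x)

  IncConnected : Set
  IncConnected = ∀ x y → Star Incomparable x y

  -- An orientation candidate: adjacency matrix, o[x][y] = true iff arrow x → y.
  Orientation : Set
  Orientation = Vec (Vec Bool n) n

  _⇒[_]_ : Fin n → Orientation → Fin n → Set
  x ⇒[ o ] y = T (lookup (lookup o x) y)

  IsOrientation : Orientation → Set
  IsOrientation o = ∀ x y →
    (Incomparable x y → (x ⇒[ o ] y ⊎ y ⇒[ o ] x) × ¬ (x ⇒[ o ] y × y ⇒[ o ] x))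
    × (¬ Incomparable x y → ¬ (x ⇒[ o ] y))

  Acyclic : Orientation → Set
  Acyclic o = ∀ x → ¬ TransClosure (λ a b → a ⇒[ o ] b) x x

  IsAcyclicOrientation : Orientation → Set
  IsAcyclicOrientation o = IsOrientation o × Acyclic o

  IsSink : Orientation → Fin n → Set
  IsSink o w = ∀ y → ¬ (w ⇒[ o ] y)

  IsSource : Orientation → Fin n → Set
  IsSource o w = ∀ y → ¬ (y ⇒[ o ] w)

  IsGreatestSink : Orientation → Fin n → Set
  IsGreatestSink o g = IsSink o g × (∀ s → IsSink o s → s ≼ g)

  IsSecondLargestSink : Orientation → Fin n → Set
  IsSecondLargestSink o s = Σ (Fin n) λ g → IsGreatestSink o g × IsSink o s × ¬ (s ≡ g)
    × (∀ s' → IsSink o s' → ¬ (s' ≡ g) → s' ≼ s)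

  IsSmallestSource : Orientation → Fin n → Set
  IsSmallestSource o m = IsSource o m × (∀ s → IsSource o s → m ≼ s)

  IsUniqueSink : Orientation → Fin n → Set
  IsUniqueSink o v = IsSink o v × (∀ s → IsSink o s → s ≡ v)

  HasOnlyOneSink : Orientation → Set
  HasOnlyOneSink o = Σ (Fin n) λ v → IsUniqueSink o v

  Circular : Orientation → Set
  Circular o = ∀ m g → IsSmallestSource o m → IsGreatestSink o g → ¬ (m ≺ g)

  flip : Orientation → Fin n → Orientation
  flip o w = tabulate λ x → tabulate λ y →
    if does (x ≟ w) ∨ does (y ≟ w)
    then lookup (lookup o y) x
    else lookup (lookup o x) y

  -- TRun A B : the process defining t, started at A, stops at B = t(A).
  -- (Repeatedly flip the second-largest sink until only one sink remains.)
  data TRun : Orientation → Orientation → Set where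
    t-done : ∀ {o} → HasOnlyOneSink o → TRun o o
    t-step : ∀ {o o' s} → IsSecondLargestSink o s → TRun (flip o s) o' → TRun o o'

  -- URun B A : the process defining u, started at B, stops at A = u(B).
  -- (Repeatedly flip the smallest source until a circular orientation is reached.)
  data URun : Orientation → Orientation → Set where
    u-done : ∀ {o} → Circular o → URun o o
    u-step : ∀ {o o' s} → ¬ Circular o → IsSmallestSource o s → URun (flip o s) o' → URun o o'

  InDomT : Fin n → Orientation → Set
  InDomT v A = IsAcyclicOrientation A × Circular A × IsGreatestSink A v

  InCodT : Fin n → Orientation → Set
  InCodT v B = IsAcyclicOrientation B × IsUniqueSink B v

module Submission where

-- Both processes keep v as greatest sink and keep the orientation "good": no source lies
-- strictly below a sink other than v.  In a good orientation one step of either process is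
-- undone by one step of the other: after flipping the second-largest sink s, s is the
-- smallest source and the orientation is not circular, so u flips s back; after u flips the
-- smallest source m (which lies below v), m is the second-largest sink, so t flips m back.
-- Induction on runs then shows that u started at t(A) ends at A, and dually.
--
-- Termination: count how often each vertex has been flipped.  Along every arrow (for t) or
-- against it (for u) the count drops by 0 or 1, so adjacent vertices of inc(P) have counts
-- differing by at most one; v is never flipped, so connectedness bounds every count by the
-- length of a path from v, and a generic bounded-counter argument shows both processes stop.

open import Defs
open import Data.Bool using (Bool; T; if_then_else_; _∨_)
open import Data.Bool.Properties using (T?)
open import Data.Empty using (⊥; ⊥-elim)
open import Data.Fin using (Fin; zero; suc)
open import Data.Fin.Properties using (_≟_; all?; any?)
open import Data.List using (List; []; _∷_; allFin)
open import Data.List.Membership.Propositional using (_∈_)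
open import Data.List.Membership.Propositional.Properties using (∈-allFin)
open import Data.List.Relation.Unary.Any using (here; there)
open import Data.Nat using (ℕ; zero; suc; _≤_; _<_; z≤n; s≤s; _∸_; _+_)
import Data.Nat.Properties as ℕ
open import Data.Product using (Σ; ∃; _×_; _,_; proj₁; proj₂)
import Data.Product as Product
open import Data.Sum using (_⊎_; inj₁; inj₂)
import Data.Sum as Sum
open import Data.Vec using (lookup; tabulate)
open import Data.Vec.Properties using (lookup∘tabulate; tabulate∘lookup; tabulate-cong)
open import Function using (_∘_; id)
open import Function.Bundles using (_⇔_; mk⇔; module Equivalence)
open import Relation.Binary.Structures using (IsPartialOrder)
open import Relation.Binary.PropositionalEquality
  using (_≡_; _≢_; refl; sym; trans; cong; subst; subst₂; module ≡-Reasoning)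
open import Relation.Binary.Construct.Closure.Transitive using (TransClosure; [_]; _∷_)
open import Relation.Binary.Construct.Closure.ReflexiveTransitive using (Star; ε; _◅_)
open import Relation.Nullary using (¬_; Dec; yes; no; does; ¬?)
open import Relation.Nullary.Decidable using (_×-dec_; _⊎-dec_; decidable-stable)

open Equivalence using (to; from)

-- A transitive relation R that is total on a decidable nonempty subset Q of Fin n has a
-- greatest element on Q.  Sinks, and sources, of an orientation of inc(P) form such chains.
greatest-in-chain : ∀ {n} {Q : Fin n → Set} {R : Fin n → Fin n → Set} →
  (∀ x → Dec (Q x)) → (∀ {a b c} → R a b → R b c → R a c) →
  (∀ {a b} → Q a → Q b → R a b ⊎ R b a) →
  ∃ Q → ∃ λ m → Q m × (∀ x → Q x → R x m)
greatest-in-chain {n} {Q} {R} Q? R-trans R-total (a , qa) =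
  let m , qm , top = greatest-among (allFin n) in m , qm , λ x qx → top x (∈-allFin x) qx
  where
  greatest-among : (xs : List (Fin n)) → ∃ λ m → Q m × (∀ x → x ∈ xs → Q x → R x m)
  greatest-among [] = a , qa , λ _ ()
  greatest-among (y ∷ ys) with greatest-among ys | Q? y
  ... | m , qm , top | no ¬qy =
    m , qm , λ { _ (here refl) qy → ⊥-elim (¬qy qy) ; x (there x∈ys) qx → top x x∈ys qx }
  ... | m , qm , top | yes qy with R-total qy qm
  ...   | inj₁ y≤m = m , qm , λ { _ (here refl) _ → y≤m ; x (there x∈ys) qx → top x x∈ys qx }
  ...   | inj₂ m≤y = y , qy , λ { _ (here refl) _ → Sum.reduce (R-total qy qy)
                                ; x (there x∈ys) qx → R-trans (top x x∈ys qx) m≤y }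

∑ : ∀ {n} → (Fin n → ℕ) → ℕ
∑ {zero} f = 0
∑ {suc n} f = f zero + ∑ (f ∘ suc)

∑-mono : ∀ {n} {f g : Fin n → ℕ} → (∀ x → f x ≤ g x) → ∑ f ≤ ∑ g
∑-mono {zero} _ = z≤n
∑-mono {suc n} f≤g = ℕ.+-mono-≤ (f≤g zero) (∑-mono (f≤g ∘ suc))

∑-mono-< : ∀ {n} {f g : Fin n → ℕ} → (∀ x → f x ≤ g x) → ∀ y → f y < g y → ∑ f < ∑ g
∑-mono-< f≤g zero fy<gy = ℕ.+-mono-<-≤ fy<gy (∑-mono (f≤g ∘ suc))
∑-mono-< f≤g (suc y) fy<gy = ℕ.+-mono-≤-< (f≤g zero) (∑-mono-< (f≤g ∘ suc) y fy<gy)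

-- A counter records how often each vertex has been flipped; bump c w counts one more flip of w.
Counter : ℕ → Set
Counter n = Fin n → ℕ

bump : ∀ {n} → Counter n → Fin n → Counter n
bump c w x with x ≟ w
... | yes _ = suc (c x)
... | no _ = c x

bump-here : ∀ {n} (c : Counter n) w → bump c w w ≡ suc (c w)
bump-here c w with w ≟ w
... | yes _ = refl
... | no w≢w = ⊥-elim (w≢w refl)

bump-elsewhere : ∀ {n} (c : Counter n) {w x} → x ≢ w → bump c w x ≡ c x
bump-elsewhere c {w} {x} x≢w with x ≟ w
... | yes x≡w = ⊥-elim (x≢w x≡w)
... | no _ = refl

bump-≥ : ∀ {n} (c : Counter n) w x → c x ≤ bump c w x
bump-≥ c w x with x ≟ w
... | yes _ = ℕ.n≤1+n (c x)
... | no _ = ℕ.≤-refl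

-- If Inv keeps all counters below a fixed bound L, the goal is reached:
-- the slack ∑ (L x ∸ c x) strictly decreases with each step.
module _ {n : ℕ} {S : Set} (L : Counter n) (Inv : S → Counter n → Set) (Goal : S → Set)
  (bounded : ∀ s c → Inv s c → ∀ x → c x ≤ L x)
  (advance : ∀ s c → Inv s c →
    Goal s ⊎ Σ (Fin n) λ w → Σ S λ s' → Inv s' (bump c w) × (Goal s' → Goal s))
  where

  slack : Counter n → ℕ
  slack c = ∑ λ x → L x ∸ c x

  slack-drops : ∀ c w → bump c w w ≤ L w → slack (bump c w) < slack c
  slack-drops c w bumped≤L =
    ∑-mono-< (λ x → ℕ.∸-monoʳ-≤ (L x) (bump-≥ c w x)) w
      (subst (λ k → L w ∸ k < L w ∸ c w) (sym (bump-here c w))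
        (ℕ.∸-monoʳ-< (ℕ.n<1+n (c w)) (subst (_≤ L w) (bump-here c w) bumped≤L)))

  reach-goal : ∀ s c → Inv s c → Goal s
  reach-goal s c inv = run (suc (slack c)) s c (ℕ.n<1+n (slack c)) inv
    where
    run : ∀ fuel s c → slack c < fuel → Inv s c → Goal s
    run (suc fuel) s c slack<fuel inv with advance s c inv
    ... | inj₁ goal = goal
    ... | inj₂ (w , s' , inv' , back) =
      back (run fuel s' (bump c w)
        (ℕ.<-≤-trans (slack-drops c w (bounded s' (bump c w) inv' w)) (ℕ.≤-pred slack<fuel)) inv')

Descending : ∀ {n} → (Fin n → Fin n → Set) → Counter n → Set
Descending R c = ∀ {x y} → R x y → c y ≤ c x × c x ≤ suc (c y)

descending-flip : ∀ {n} {R R' : Fin n → Fin n → Set} {c w} →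
  (∀ y → ¬ R w y) →
  (∀ {x y} → x ≡ w ⊎ y ≡ w → R' x y → R y x) →
  (∀ {x y} → x ≢ w → y ≢ w → R' x y → R x y) →
  Descending R c → Descending R' (bump c w)
descending-flip {w = w} w-sink at away desc {x} {y} r' with x ≟ w | y ≟ w
... | _ | yes refl = ⊥-elim (w-sink x (at (inj₂ refl) r'))
... | yes refl | no _ = let cw≤cy , cy≤1+cw = desc (at (inj₁ refl) r') in cy≤1+cw , s≤s cw≤cy
... | no x≢w | no y≢w = desc (away x≢w y≢w r')

descending-step-bound : ∀ {n} {E R : Fin n → Fin n → Set} {c : Counter n} →
  (∀ {x y} → E x y → R x y ⊎ R y x) → Descending R c → ∀ {x y} → E x y → c y ≤ suc (c x)
descending-step-bound orients desc e with orients e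
... | inj₁ r = ℕ.≤-trans (proj₁ (desc r)) (ℕ.n≤1+n _)
... | inj₂ r = proj₂ (desc r)

path-length : ∀ {A : Set} {E : A → A → Set} {a b} → Star E a b → ℕ
path-length ε = 0
path-length (_ ◅ p) = suc (path-length p)

path-bound : ∀ {n} {E : Fin n → Fin n → Set} {c : Counter n} →
  (∀ {x y} → E x y → c y ≤ suc (c x)) → ∀ {a b} (p : Star E a b) → c b ≤ path-length p + c a
path-bound step ε = ℕ.≤-refl
path-bound {c = c} step {a} {b} (_◅_ {j = y} e p) = begin
  c b                       ≤⟨ path-bound step p ⟩
  path-length p + c y       ≤⟨ ℕ.+-monoʳ-≤ (path-length p) (step e) ⟩
  path-length p + suc (c a) ≡⟨ ℕ.+-suc (path-length p) (c a) ⟩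
  suc (path-length p + c a) ∎
  where open ℕ.≤-Reasoning

first-arrow : ∀ {A : Set} {R : A → A → Set} {a b} → TransClosure R a b → ∃ (R a)
first-arrow [ r ] = _ , r
first-arrow (r ∷ _) = _ , r

last-arrow : ∀ {A : Set} {R : A → A → Set} {a b} → TransClosure R a b → ∃ λ z → R z b
last-arrow [ r ] = _ , r
last-arrow (_ ∷ rs) = last-arrow rs

lift-path-into : ∀ {A : Set} {R S : A → A → Set} {w} →
  (∀ {x y} → R x y → y ≢ w) → (∀ {x y} → x ≢ w → y ≢ w → R x y → S x y) →
  ∀ {a b} → a ≢ w → TransClosure R a b → TransClosure S a b
lift-path-into no-in lift a≢w [ r ] = [ lift a≢w (no-in r) r ]
lift-path-into no-in lift a≢w (r ∷ rs) = lift a≢w (no-in r) r ∷ lift-path-into no-in lift (no-in r) rs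

lift-path-out-of : ∀ {A : Set} {R S : A → A → Set} {w} →
  (∀ {x y} → R x y → x ≢ w) → (∀ {x y} → x ≢ w → y ≢ w → R x y → S x y) →
  ∀ {a b} → b ≢ w → TransClosure R a b → TransClosure S a b
lift-path-out-of no-out lift b≢w [ r ] = [ lift (no-out r) b≢w r ]
lift-path-out-of no-out lift b≢w (r ∷ rs) =
  lift (no-out r) (no-out (proj₂ (first-arrow rs))) r ∷ lift-path-out-of no-out lift b≢w rs

module Orientations {n : ℕ} (P : FinPoset n) where
  open FinPoset P
  open IsPartialOrder isPartialOrder using ()
    renaming (refl to ≼-refl; trans to ≼-trans; antisym to ≼-antisym)

  _≺ₚ_ : Fin n → Fin n → Set
  _≺ₚ_ = _≺_ P

  Inc : Fin n → Fin n → Set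
  Inc = Incomparable P

  _⇒⟨_⟩_ : Fin n → Orientation P → Fin n → Set
  x ⇒⟨ o ⟩ y = _⇒[_]_ P x o y

  ≺⇒⋡ : ∀ {a b} → a ≺ₚ b → b ≼ a → ⊥
  ≺⇒⋡ (a≼b , a≢b) b≼a = a≢b (≼-antisym a≼b b≼a)

  incomparable-or-comparable : ∀ x y → Inc x y ⊎ (x ≼ y ⊎ y ≼ x)
  incomparable-or-comparable x y with x ≼? y | y ≼? x
  ... | yes x≼y | _ = inj₂ (inj₁ x≼y)
  ... | no _ | yes y≼x = inj₂ (inj₂ y≼x)
  ... | no x⋠y | no y⋠x = inj₁ (x⋠y , y⋠x)

  _≺?_ : ∀ x y → Dec (x ≺ₚ y)
  x ≺? y = (x ≼? y) ×-dec ¬? (x ≟ y)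

  arrow? : ∀ o x y → Dec (x ⇒⟨ o ⟩ y)
  arrow? o x y = T? _

  sink? : ∀ o w → Dec (IsSink P o w)
  sink? o w = all? λ y → ¬? (arrow? o w y)

  source? : ∀ o w → Dec (IsSource P o w)
  source? o w = all? λ y → ¬? (arrow? o y w)

  entry : Orientation P → Fin n → Fin n → Bool
  entry o x y = lookup (lookup o x) y

  flip-entry : ∀ o w x y → entry (flip P o w) x y ≡
    (if does (x ≟ w) ∨ does (y ≟ w) then entry o y x else entry o x y)
  flip-entry o w x y = trans (cong (λ row → lookup row y) (lookup∘tabulate _ x)) (lookup∘tabulate _ y)

  flip-entry-at : ∀ o w {x y} → x ≡ w ⊎ y ≡ w → entry (flip P o w) x y ≡ entry o y x
  flip-entry-at o w {x} {y} touches rewrite flip-entry o w x y with x ≟ w | y ≟ w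
  ... | yes _ | _ = refl
  ... | no _ | yes _ = refl
  ... | no x≢w | no y≢w = ⊥-elim (Sum.[ x≢w , y≢w ] touches)

  flip-entry-away : ∀ o w {x y} → x ≢ w → y ≢ w → entry (flip P o w) x y ≡ entry o x y
  flip-entry-away o w {x} {y} x≢w y≢w rewrite flip-entry o w x y with x ≟ w | y ≟ w
  ... | yes x≡w | _ = ⊥-elim (x≢w x≡w)
  ... | no _ | yes y≡w = ⊥-elim (y≢w y≡w)
  ... | no _ | no _ = refl

  flip-at : ∀ o w {x y} → x ≡ w ⊎ y ≡ w → (x ⇒⟨ flip P o w ⟩ y) ⇔ (y ⇒⟨ o ⟩ x)
  flip-at o w touches = mk⇔ (subst T e) (subst T (sym e))
    where e = flip-entry-at o w touches

  flip-away : ∀ o w {x y} → x ≢ w → y ≢ w → (x ⇒⟨ flip P o w ⟩ y) ⇔ (x ⇒⟨ o ⟩ y)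
  flip-away o w x≢w y≢w = mk⇔ (subst T e) (subst T (sym e))
    where e = flip-entry-away o w x≢w y≢w

  orientation-ext : ∀ o o' → (∀ x y → entry o x y ≡ entry o' x y) → o ≡ o'
  orientation-ext o o' same = begin
    o                                                        ≡⟨ sym (tabulate∘lookup o) ⟩
    tabulate (λ x → lookup o x)                              ≡⟨ tabulate-cong row ⟩
    tabulate (λ x → lookup o' x)                             ≡⟨ tabulate∘lookup o' ⟩
    o'                                                       ∎
    where
    open ≡-Reasoning
    row : ∀ x → lookup o x ≡ lookup o' x
    row x = trans (sym (tabulate∘lookup (lookup o x)))
              (trans (tabulate-cong (same x)) (tabulate∘lookup (lookup o' x)))

  flip-involutive : ∀ o w → flip P (flip P o w) w ≡ o
  flip-involutive o w = orientation-ext _ _ twice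
    where
    twice : ∀ x y → entry (flip P (flip P o w) w) x y ≡ entry o x y
    twice x y with (x ≟ w) ⊎-dec (y ≟ w)
    ... | yes touches = trans (flip-entry-at (flip P o w) w touches) (flip-entry-at o w (Sum.swap touches))
    ... | no avoids = trans (flip-entry-away (flip P o w) w (avoids ∘ inj₁) (avoids ∘ inj₂))
                            (flip-entry-away o w (avoids ∘ inj₁) (avoids ∘ inj₂))

  OrientedPair : Orientation P → Fin n → Fin n → Set
  OrientedPair o x y =
    (Inc x y → (x ⇒⟨ o ⟩ y ⊎ y ⇒⟨ o ⟩ x) × ¬ (x ⇒⟨ o ⟩ y × y ⇒⟨ o ⟩ x))
    × (¬ Inc x y → ¬ (x ⇒⟨ o ⟩ y))

  oriented-pair-transfer : ∀ o o' {x y a b} → (Inc x y → Inc a b) → (Inc a b → Inc x y) →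
    (x ⇒⟨ o' ⟩ y ⇔ a ⇒⟨ o ⟩ b) → (y ⇒⟨ o' ⟩ x ⇔ b ⇒⟨ o ⟩ a) →
    OrientedPair o a b → OrientedPair o' x y
  oriented-pair-transfer _ _ inc inc⁻ fwd bwd (one-way , none) =
    (λ i → Sum.map (from fwd) (from bwd) (proj₁ (one-way (inc i)))
         , λ (p , q) → proj₂ (one-way (inc i)) (to fwd p , to bwd q))
    , λ ¬i a → none (¬i ∘ inc⁻) (to fwd a)

  orientation-flip : ∀ o w → IsOrientation P o → IsOrientation P (flip P o w)
  orientation-flip o w io x y with (x ≟ w) ⊎-dec (y ≟ w)
  ... | yes touches = oriented-pair-transfer o (flip P o w) Product.swap Product.swap
                        (flip-at o w touches) (flip-at o w (Sum.swap touches)) (io y x)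
  ... | no avoids = oriented-pair-transfer o (flip P o w) id id
                      (flip-away o w (avoids ∘ inj₁) (avoids ∘ inj₂))
                      (flip-away o w (avoids ∘ inj₂) (avoids ∘ inj₁)) (io x y)

  arrow⇒incomparable : ∀ o {x y} → IsOrientation P o → x ⇒⟨ o ⟩ y → Inc x y
  arrow⇒incomparable o {x} {y} io a =
    (λ x≼y → no-edge (λ i → proj₁ i x≼y)) , (λ y≼x → no-edge (λ i → proj₂ i y≼x))
    where
    no-edge : ¬ Inc x y → ⊥
    no-edge ¬i = proj₂ (io x y) ¬i a

  incomparable⇒arrow : ∀ o {x y} → IsOrientation P o → Inc x y → x ⇒⟨ o ⟩ y ⊎ y ⇒⟨ o ⟩ x
  incomparable⇒arrow _ {x} {y} io i = proj₁ (proj₁ (io x y) i)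

  -- Two sinks, or two sources, are not joined by an arrow, hence comparable.
  sinks-comparable : ∀ o {a b} → IsOrientation P o → IsSink P o a → IsSink P o b → a ≼ b ⊎ b ≼ a
  sinks-comparable o {a} {b} io a-sink b-sink with incomparable-or-comparable a b
  ... | inj₁ i = ⊥-elim (Sum.[ a-sink b , b-sink a ] (incomparable⇒arrow o io i))
  ... | inj₂ comparable = comparable

  sources-comparable : ∀ o {a b} → IsOrientation P o → IsSource P o a → IsSource P o b → a ≼ b ⊎ b ≼ a
  sources-comparable o {a} {b} io a-source b-source with incomparable-or-comparable a b
  ... | inj₁ i = ⊥-elim (Sum.[ b-source a , a-source b ] (incomparable⇒arrow o io i))
  ... | inj₂ comparable = comparable

  smallest-source : ∀ o → IsOrientation P o → ∃ (IsSource P o) → ∃ (IsSmallestSource P o)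
  smallest-source o io =
    greatest-in-chain (source? o) (λ p q → ≼-trans q p) (λ a b → Sum.swap (sources-comparable o io a b))

  greatest-sink-unique : ∀ o {g g'} → IsGreatestSink P o g → IsGreatestSink P o g' → g ≡ g'
  greatest-sink-unique _ (g-sink , g-top) (g'-sink , g'-top) = ≼-antisym (g'-top _ g-sink) (g-top _ g'-sink)

  smallest-source-unique : ∀ o {m m'} → IsSmallestSource P o m → IsSmallestSource P o m' → m ≡ m'
  smallest-source-unique _ (m-source , m-low) (m'-source , m'-low) =
    ≼-antisym (m-low _ m'-source) (m'-low _ m-source)

  circular-if : ∀ o {m g} → IsSmallestSource P o m → IsGreatestSink P o g → ¬ m ≺ₚ g → Circular P o
  circular-if o sm gs m⊀g m' g' sm' gs' m'≺g' =
    m⊀g (subst₂ _≺ₚ_ (smallest-source-unique o sm' sm) (greatest-sink-unique o gs' gs) m'≺g')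

  below-if-not-circular : ∀ o {m g} → ¬ Circular P o → IsSmallestSource P o m →
    IsGreatestSink P o g → m ≺ₚ g
  below-if-not-circular o {m} {g} ¬circ sm gs with m ≺? g
  ... | yes m≺g = m≺g
  ... | no m⊀g = ⊥-elim (¬circ (circular-if o sm gs m⊀g))

  flipped-sink-is-source : ∀ o {w} → IsSink P o w → IsSource P (flip P o w) w
  flipped-sink-is-source o {w} w-sink y y⇒w = w-sink y (to (flip-at o w (inj₂ refl)) y⇒w)

  flipped-source-is-sink : ∀ o {w} → IsSource P o w → IsSink P (flip P o w) w
  flipped-source-is-sink o {w} w-source y w⇒y = w-source y (to (flip-at o w (inj₁ refl)) w⇒y)

  sink-after-flip : ∀ o {w s} → IsSink P (flip P o w) s → s ≢ w → IsSink P o s ⊎ s ⇒⟨ o ⟩ w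
  sink-after-flip o {w} {s} s-sink s≢w with arrow? o s w
  ... | yes s⇒w = inj₂ s⇒w
  ... | no s⇏w = inj₁ no-out
    where
    no-out : ∀ y → ¬ s ⇒⟨ o ⟩ y
    no-out y s⇒y with y ≟ w
    ... | yes refl = s⇏w s⇒y
    ... | no y≢w = s-sink y (from (flip-away o w s≢w y≢w) s⇒y)

  source-after-flip : ∀ o {w m} → IsSource P (flip P o w) m → m ≢ w → IsSource P o m ⊎ w ⇒⟨ o ⟩ m
  source-after-flip o {w} {m} m-source m≢w with arrow? o w m
  ... | yes w⇒m = inj₂ w⇒m
  ... | no w⇏m = inj₁ no-in
    where
    no-in : ∀ y → ¬ y ⇒⟨ o ⟩ m
    no-in y y⇒m with y ≟ w
    ... | yes refl = w⇏m y⇒m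
    ... | no y≢w = m-source y (from (flip-away o w y≢w m≢w) y⇒m)

  sink-after-source-flip : ∀ o {w s} → IsSource P o w → IsSink P (flip P o w) s → s ≢ w → IsSink P o s
  sink-after-source-flip o {s = s} w-source s-sink s≢w =
    Sum.[ id , (λ s⇒w → ⊥-elim (w-source s s⇒w)) ] (sink-after-flip o s-sink s≢w)

  source-after-sink-flip : ∀ o {w m} → IsSink P o w → IsSource P (flip P o w) m → m ≢ w → IsSource P o m
  source-after-sink-flip o {m = m} w-sink m-source m≢w =
    Sum.[ id , (λ w⇒m → ⊥-elim (w-sink m w⇒m)) ] (source-after-flip o m-source m≢w)

  sink-survives-flip : ∀ o {w v} → IsSink P o v → w ≢ v → ¬ w ⇒⟨ o ⟩ v → IsSink P (flip P o w) v
  sink-survives-flip o {w} v-sink w≢v w⇏v y v⇒y with y ≟ w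
  ... | yes refl = w⇏v (to (flip-at o y (inj₂ refl)) v⇒y)
  ... | no y≢w = v-sink y (to (flip-away o w (w≢v ∘ sym) y≢w) v⇒y)

  -- Flipping a sink or source creates no cycle: afterwards w is a source (resp. sink), so a
  -- cycle avoids w, and away from w the arrows are those of o.
  acyclic-flip : ∀ o {w} → IsSink P o w ⊎ IsSource P o w → Acyclic P o → Acyclic P (flip P o w)
  acyclic-flip o {w} (inj₁ w-sink) acyclic x cycle =
    acyclic x (lift-path-into no-in keep (no-in (proj₂ (last-arrow cycle))) cycle)
    where
    no-in : ∀ {a b} → a ⇒⟨ flip P o w ⟩ b → b ≢ w
    no-in {a} a⇒w refl = flipped-sink-is-source o w-sink a a⇒w
    keep : ∀ {a b} → a ≢ w → b ≢ w → a ⇒⟨ flip P o w ⟩ b → a ⇒⟨ o ⟩ b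
    keep a≢w b≢w = to (flip-away o w a≢w b≢w)
  acyclic-flip o {w} (inj₂ w-source) acyclic x cycle =
    acyclic x (lift-path-out-of no-out keep (no-out (proj₂ (first-arrow cycle))) cycle)
    where
    no-out : ∀ {a b} → a ⇒⟨ flip P o w ⟩ b → a ≢ w
    no-out {b = b} w⇒b refl = flipped-source-is-sink o w-source b w⇒b
    keep : ∀ {a b} → a ≢ w → b ≢ w → a ⇒⟨ flip P o w ⟩ b → a ⇒⟨ o ⟩ b
    keep a≢w b≢w = to (flip-away o w a≢w b≢w)

  acyclic-orientation-flip : ∀ o {w} → IsSink P o w ⊎ IsSource P o w →
    IsAcyclicOrientation P o → IsAcyclicOrientation P (flip P o w)
  acyclic-orientation-flip o {w} sink-or-source (io , acyclic) =
    orientation-flip o w io , acyclic-flip o sink-or-source acyclic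

  module SinkAt (v : Fin n) where

    Separated : Orientation P → Set
    Separated o = ∀ {m s} → IsSource P o m → IsSink P o s → s ≢ v → ¬ m ≺ₚ s

    record Good (o : Orientation P) : Set where
      field
        orientation : IsOrientation P o
        greatest    : IsGreatestSink P o v
        separated   : Separated o

    -- Domain and codomain of t consist of good orientations.  A circular one is separated:
    -- a source below a sink s ≠ v would put the smallest source strictly below v.
    good-if-circular : ∀ o → IsOrientation P o → Circular P o → IsGreatestSink P o v → Good o
    good-if-circular o io circ gs = record { orientation = io ; greatest = gs ; separated = separated }
      where
      separated : Separated o
      separated {m} {s} m-source s-sink s≢v (m≼s , _) with smallest-source o io (m , m-source)
      ... | m₀ , smallest@(_ , m₀-low) = circ m₀ v smallest gs (m₀≼v , m₀≢v)
        where
        s≼v = proj₂ gs s s-sink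
        m₀≼s = ≼-trans (m₀-low m m-source) m≼s
        m₀≼v = ≼-trans m₀≼s s≼v
        m₀≢v : m₀ ≢ v
        m₀≢v m₀≡v = s≢v (≼-antisym s≼v (subst (_≼ s) m₀≡v m₀≼s))

    good-if-unique : ∀ o → IsOrientation P o → IsUniqueSink P o v → Good o
    good-if-unique o io (v-sink , only) = record
      { orientation = io
      ; greatest = v-sink , λ s s-sink → subst (_≼ v) (sym (only s s-sink)) ≼-refl
      ; separated = λ {_} {s} _ s-sink s≢v _ → s≢v (only s s-sink)
      }

    IsSecondSink : Orientation P → Fin n → Set
    IsSecondSink o s = IsSink P o s × s ≢ v × (∀ s' → IsSink P o s' → s' ≢ v → s' ≼ s)

    second-sink-from : ∀ o {s} → IsGreatestSink P o v → IsSecondLargestSink P o s → IsSecondSink o s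
    second-sink-from o gs (g , gg , s-sink , s≢g , top) =
      s-sink , (λ s≡v → s≢g (trans s≡v (sym g≡v))) , λ s' s'-sink s'≢v → top s' s'-sink (λ e → s'≢v (trans e g≡v))
      where g≡v = greatest-sink-unique o gg gs

    greatest-after-t : ∀ o {s} → IsOrientation P o → IsGreatestSink P o v → IsSink P o s → s ≢ v →
      IsGreatestSink P (flip P o s) v
    greatest-after-t o {s} io (v-sink , top) s-sink s≢v = v-sink' , top'
      where
      v-sink' = sink-survives-flip o v-sink s≢v (s-sink v)
      top' : ∀ s' → IsSink P (flip P o s) s' → s' ≼ v
      top' s' s'-sink with s' ≟ s
      ... | yes refl = top s' s-sink
      ... | no s'≢s with sink-after-flip o s'-sink s'≢s
      ...   | inj₁ s'-sink₀ = top s' s'-sink₀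
      ...   | inj₂ s'⇒s with sinks-comparable (flip P o s) (orientation-flip o s io) s'-sink v-sink'
      ...     | inj₁ s'≼v = s'≼v
      ...     | inj₂ v≼s' = ⊥-elim (proj₂ (arrow⇒incomparable o io s'⇒s) (≼-trans (top s s-sink) v≼s'))

    greatest-after-u : ∀ o {m} → IsOrientation P o → IsGreatestSink P o v → IsSource P o m → m ≺ₚ v →
      IsGreatestSink P (flip P o m) v
    greatest-after-u o {m} io (v-sink , top) m-source (m≼v , m≢v) =
      sink-survives-flip o v-sink m≢v (λ m⇒v → proj₁ (arrow⇒incomparable o io m⇒v) m≼v) , top'
      where
      top' : ∀ s' → IsSink P (flip P o m) s' → s' ≼ v
      top' s' s'-sink with s' ≟ m
      ... | yes refl = m≼v
      ... | no s'≢m = top s' (sink-after-source-flip o m-source s'-sink s'≢m)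

    smallest-source-after-t : ∀ {o s} → Good o → IsSecondSink o s → IsSmallestSource P (flip P o s) s
    smallest-source-after-t {o} {s} good (s-sink , s≢v , _) = s-source , lowest
      where
      open Good good
      s-source = flipped-sink-is-source o s-sink
      lowest : ∀ m → IsSource P (flip P o s) m → s ≼ m
      lowest m m-source with m ≟ s
      ... | yes refl = ≼-refl
      ... | no m≢s with sources-comparable (flip P o s) (orientation-flip o s orientation) s-source m-source
      ...   | inj₁ s≼m = s≼m
      ...   | inj₂ m≼s = ⊥-elim (separated (source-after-sink-flip o s-sink m-source m≢s) s-sink s≢v (m≼s , m≢s))

    separated-after-t : ∀ o {s} → IsOrientation P o → IsSecondSink o s →
      (∀ m → IsSource P (flip P o s) m → s ≼ m) → Separated (flip P o s)
    separated-after-t o {s} io (s-sink , _ , top) lowest {m'} {s'} m'-source s'-sink s'≢v m'≺s'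
      with s' ≟ s
    ... | yes refl = ≺⇒⋡ m'≺s' (lowest m' m'-source)
    ... | no s'≢s with sink-after-flip o s'-sink s'≢s
    ...   | inj₁ s'-sink₀ = ≺⇒⋡ m'≺s' (≼-trans (top s' s'-sink₀ s'≢v) (lowest m' m'-source))
    ...   | inj₂ s'⇒s = proj₂ (arrow⇒incomparable o io s'⇒s) (≼-trans (lowest m' m'-source) (proj₁ m'≺s'))

    after-t-step : ∀ {o s} → Good o → IsSecondLargestSink P o s →
      Good (flip P o s) × IsSmallestSource P (flip P o s) s × ¬ Circular P (flip P o s)
    after-t-step {o} {s} good second-largest
      with second-sink-from o (Good.greatest good) second-largest
    ... | second@(s-sink , s≢v , _) = good' , smallest , not-circular
      where
      open Good good
      greatest' = greatest-after-t o orientation greatest s-sink s≢v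
      smallest = smallest-source-after-t good second
      good' : Good (flip P o s)
      good' = record
        { orientation = orientation-flip o s orientation
        ; greatest = greatest'
        ; separated = separated-after-t o orientation second (proj₂ smallest)
        }
      not-circular : ¬ Circular P (flip P o s)
      not-circular circ = circ s v smallest greatest' (proj₂ greatest s s-sink , s≢v)

    second-sink-after-u : ∀ {o m} → Good o → IsSource P o m → m ≺ₚ v → IsSecondSink (flip P o m) m
    second-sink-after-u {o} {m} good m-source (_ , m≢v) = m-sink , m≢v , highest
      where
      open Good good
      m-sink = flipped-source-is-sink o m-source
      highest : ∀ s' → IsSink P (flip P o m) s' → s' ≢ v → s' ≼ m
      highest s' s'-sink s'≢v with s' ≟ m
      ... | yes refl = ≼-refl
      ... | no s'≢m with sinks-comparable (flip P o m) (orientation-flip o m orientation) s'-sink m-sink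
      ...   | inj₁ s'≼m = s'≼m
      ...   | inj₂ m≼s' = ⊥-elim (separated m-source (sink-after-source-flip o m-source s'-sink s'≢m)
                                    s'≢v (m≼s' , s'≢m ∘ sym))

    separated-after-u : ∀ o {m} → IsOrientation P o → IsSmallestSource P o m →
      (∀ s' → IsSink P (flip P o m) s' → s' ≢ v → s' ≼ m) → Separated (flip P o m)
    separated-after-u o {m} io (_ , lowest) highest {m'} {s'} m'-source s'-sink s'≢v m'≺s'
      with m' ≟ m
    ... | yes refl = ≺⇒⋡ m'≺s' (highest s' s'-sink s'≢v)
    ... | no m'≢m with source-after-flip o m'-source m'≢m
    ...   | inj₁ m'-source₀ = ≺⇒⋡ m'≺s' (≼-trans (highest s' s'-sink s'≢v) (lowest m' m'-source₀))
    ...   | inj₂ m⇒m' = proj₂ (arrow⇒incomparable o io m⇒m') (≼-trans (proj₁ m'≺s') (highest s' s'-sink s'≢v))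

    after-u-step : ∀ {o m} → Good o → ¬ Circular P o → IsSmallestSource P o m →
      Good (flip P o m) × IsSecondLargestSink P (flip P o m) m
    after-u-step {o} {m} good ¬circ smallest = good' , (v , greatest' , second)
      where
      open Good good
      m≺v = below-if-not-circular o ¬circ smallest greatest
      second = second-sink-after-u good (proj₁ smallest) m≺v
      greatest' = greatest-after-u o orientation greatest (proj₁ smallest) m≺v
      good' : Good (flip P o m)
      good' = record
        { orientation = orientation-flip o m orientation
        ; greatest = greatest'
        ; separated = separated-after-u o orientation smallest (proj₂ (proj₂ second))
        }

    t-undone-by-u : ∀ {o A B} → Good o → TRun P o B → URun P o A → URun P B A
    t-undone-by-u good (t-done _) ua = ua
    t-undone-by-u {o} {A} good (t-step {s = s} second-largest run) ua
      with after-t-step good second-largest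
    ... | good' , smallest , ¬circ =
      t-undone-by-u good' run
        (u-step ¬circ smallest (subst (λ o' → URun P o' A) (sym (flip-involutive o s)) ua))

    u-undone-by-t : ∀ {o A B} → Good o → URun P o A → TRun P o B → TRun P A B
    u-undone-by-t good (u-done _) tb = tb
    u-undone-by-t {o} {B = B} good (u-step {s = m} ¬circ smallest run) tb
      with after-u-step good ¬circ smallest
    ... | good' , second-largest =
      u-undone-by-t good' run
        (t-step second-largest (subst (λ o' → TRun P o' B) (sym (flip-involutive o m)) tb))

    u-inverts-t : (A B : Orientation P) → InDomT P v A → TRun P A B → URun P B A
    u-inverts-t A B ((io , _) , circ , gs) run = t-undone-by-u (good-if-circular A io circ gs) run (u-done circ)

    t-inverts-u : (A B : Orientation P) → InCodT P v B → URun P B A → TRun P A B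
    t-inverts-u A B ((io , _) , unique) run = u-undone-by-t (good-if-unique B io unique) run (t-done (v , unique))

    module Terminating (connected : IncConnected P) where

      budget : Counter n
      budget x = path-length (connected v x)

      within-budget : ∀ {R : Fin n → Fin n → Set} {c} → (∀ {x y} → Inc x y → R x y ⊎ R y x) →
        Descending R c → c v ≡ 0 → ∀ x → c x ≤ budget x
      within-budget {c = c} orients desc cv≡0 x =
        subst (c x ≤_) (trans (cong (budget x +_) cv≡0) (ℕ.+-identityʳ (budget x)))
          (path-bound {c = c} (descending-step-bound {c = c} orients desc) (connected v x))

      TState : Orientation P → Counter n → Set
      TState o c = IsAcyclicOrientation P o × IsGreatestSink P o v × Descending (_⇒⟨ o ⟩_) c × c v ≡ 0

      t-terminates : (A : Orientation P) → InDomT P v A →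
        Σ (Orientation P) λ B → TRun P A B × InCodT P v B
      t-terminates A (ao , _ , gs) =
        reach-goal budget TState Goal bounded advance A (λ _ → 0) (ao , gs , (λ _ → z≤n , z≤n) , refl)
        where
        Goal : Orientation P → Set
        Goal o = Σ (Orientation P) λ B → TRun P o B × InCodT P v B
        bounded : ∀ o c → TState o c → ∀ x → c x ≤ budget x
        bounded o _ ((io , _) , _ , desc , cv≡0) = within-budget (incomparable⇒arrow o io) desc cv≡0
        advance : ∀ o c → TState o c →
          Goal o ⊎ Σ (Fin n) λ s → Σ (Orientation P) λ o' → TState o' (bump c s) × (Goal o' → Goal o)
        advance o c (ao@(io , _) , gs , desc , cv≡0) with any? (λ s → sink? o s ×-dec ¬? (s ≟ v))
        ... | no no-other = inj₁ (o , t-done (v , unique) , ao , unique)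
          where
          unique : IsUniqueSink P o v
          unique = proj₁ gs , λ s s-sink → decidable-stable (s ≟ v)
                                             (λ s≢v → no-other (s , s-sink , s≢v))
        ... | yes other
          with greatest-in-chain (λ s → sink? o s ×-dec ¬? (s ≟ v)) ≼-trans
                 (λ qa qb → sinks-comparable o io (proj₁ qa) (proj₁ qb)) other
        ...   | s , (s-sink , s≢v) , top =
          inj₂ (s , flip P o s , state' , λ (B , run , cod) → B , t-step second-largest run , cod)
          where
          second-largest : IsSecondLargestSink P o s
          second-largest = v , gs , s-sink , s≢v , λ s' s'-sink s'≢v → top s' (s'-sink , s'≢v)
          state' : TState (flip P o s) (bump c s)
          state' = acyclic-orientation-flip o (inj₁ s-sink) ao
                 , greatest-after-t o io gs s-sink s≢v
                 , descending-flip s-sink (λ t → to (flip-at o s t)) (λ x≢s y≢s → to (flip-away o s x≢s y≢s)) desc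
                 , trans (bump-elsewhere c (s≢v ∘ sym)) cv≡0

      UState : Orientation P → Counter n → Set
      UState o c = IsAcyclicOrientation P o × IsGreatestSink P o v × Descending (λ x y → y ⇒⟨ o ⟩ x) c × c v ≡ 0

      u-terminates : (B : Orientation P) → InCodT P v B →
        Σ (Orientation P) λ A → URun P B A × InDomT P v A
      u-terminates B (ao@(io , _) , unique) =
        reach-goal budget UState Goal bounded advance B (λ _ → 0)
          (ao , Good.greatest (good-if-unique B io unique) , (λ _ → z≤n , z≤n) , refl)
        where
        Goal : Orientation P → Set
        Goal o = Σ (Orientation P) λ A → URun P o A × InDomT P v A
        bounded : ∀ o c → UState o c → ∀ x → c x ≤ budget x
        bounded o _ ((io , _) , _ , desc , cv≡0) = within-budget (Sum.swap ∘ incomparable⇒arrow o io) desc cv≡0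
        advance : ∀ o c → UState o c →
          Goal o ⊎ Σ (Fin n) λ m → Σ (Orientation P) λ o' → UState o' (bump c m) × (Goal o' → Goal o)
        advance o c (ao@(io , _) , gs , desc , cv≡0) with any? (source? o)
        ... | no no-source = inj₁ (o , u-done circ , ao , circ , gs)
          where
          circ : Circular P o
          circ m _ (m-source , _) _ _ = no-source (m , m-source)
        ... | yes some with smallest-source o io some
        ...   | m , smallest@(m-source , _) with m ≺? v
        ...     | no m⊀v = inj₁ (o , u-done circ , ao , circ , gs)
          where circ = circular-if o smallest gs m⊀v
        ...     | yes m≺v = inj₂ (m , flip P o m , state' , λ (A , run , dom) → A , u-step ¬circ smallest run , dom)
          where
          ¬circ : ¬ Circular P o
          ¬circ circ = circ m v smallest gs m≺v
          state' : UState (flip P o m) (bump c m)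
          state' = acyclic-orientation-flip o (inj₂ m-source) ao
                 , greatest-after-u o io gs m-source m≺v
                 , descending-flip m-source (λ t → to (flip-at o m (Sum.swap t)))
                     (λ x≢m y≢m → to (flip-away o m y≢m x≢m)) desc
                 , trans (bump-elsewhere c (proj₂ m≺v ∘ sym)) cv≡0

proposition3p9 : {n : ℕ} (P : FinPoset n) → IncConnected P → (v : Fin n) →
    ((A : Orientation P) → InDomT P v A →
      Σ (Orientation P) λ B → TRun P A B × InCodT P v B)
    × ((B : Orientation P) → InCodT P v B →
      Σ (Orientation P) λ A → URun P B A × InDomT P v A)
    × ((A B : Orientation P) → InDomT P v A → TRun P A B → URun P B A)
    × ((A B : Orientation P) → InCodT P v B → URun P B A → TRun P A B)
proposition3p9 P connected v = t-terminates , u-terminates , u-inverts-t , t-inverts-u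
  where
  open Orientations P
  open SinkAt v
  open Terminating connected
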